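{- Let $\mathcal R$ be a polarized rewrite system such that $\longrightarrow_{ - }$ and $\longrightarrow_{+}$ commute and that has a pre-model, and fix such a pre-model of $\mathcal R$. Let $A$ be a proposition, $\pi$ a proof-term of $\Gamma \vdash_{\mathcal R} A$, and $\sigma$ a substitution defined on some of the proof variables declared in $\Gamma$ such that $\sigma(\alpha) \in |B|$ whenever $\alpha : B \in \Gamma$ and $\sigma$ is defined on $\alpha$. Then $\sigma\pi \in |A|$.
   Context: Propositions are built from atomic propositions (propositional symbols) and the constant $\bot$ using the binary connectives $\Rightarrow$, $\wedge$, $\vee$. A rewrite rule is a pair $P \longrightarrow A$ with $P$ an atomic proposition and $A$ an arbitrary proposition. A polarized rewrite system $\mathcal R = \langle \mathcal R_{ - }, \mathcal R_{+}\rangle$ is a pair of sets of rewrite rules; rules of $\mathcal R_{ - }$ are called negative, those of $\mathcal R_{+}$ positive. The one-step relations $\longrightarrow^1_{ - }$, $\longrightarrow^1_{+}$ are the least relations on propositions such that: $P \longrightarrow^1_{ - } A$ for every negative rule $P \longrightarrow A$; $P \longrightarrow^1_{+} A$ for every positive rule $P\longrightarrow A$; $A \Rightarrow B \longrightarrow^1_{ - } A' \Rightarrow B$ if $A \longrightarrow^1_{+} A'$, and $A \Rightarrow B \longrightarrow^1_{ - } A \Rightarrow B'$ if $B \longrightarrow^1_{ - } B'$; $A \Rightarrow B \longrightarrow^1_{+} A' \Rightarrow B$ if $A \longrightarrow^1_{ - } A'$, and $A \Rightarrow B \longrightarrow^1_{+} A \Rightarrow B'$ if $B \longrightarrow^1_{+}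 B'$; for $\circ \in \{\wedge, \vee\}$ and $s \in \{ -,+\}$, $A \circ B \longrightarrow^1_{s} A' \circ B$ if $A \longrightarrow^1_{s} A'$, and $A \circ B \longrightarrow^1_{s} A \circ B'$ if $B \longrightarrow^1_{s} B'$. The relations $\longrightarrow_{ - }$, $\longrightarrow_{+}$ are the reflexive-transitive closures of $\longrightarrow^1_{ - }$, $\longrightarrow^1_{+}$; $B \longleftarrow_{s} A$ means $A \longrightarrow_{s} B$. They commute if whenever $A \longleftarrow_{ - } B \longrightarrow_{+} C$ there is $D$ with $A \longrightarrow_{+} D \longleftarrow_{ - } C$. Proof-terms: $\pi ::= \alpha \mid \lambda\alpha\,\pi \mid (\pi_1\,\pi_2) \mid \langle \pi_1,\pi_2\rangle \mid \mathit{fst}(\pi) \mid \mathit{snd}(\pi) \mid i(\pi) \mid j(\pi) \mid \delta(\pi_1, \alpha\pi_2, \beta\pi_3) \mid \delta_\bot(\pi)$, with $\alpha,\beta$ proof variables ($\lambda\alpha$ binds $\alpha$; in $\delta(\pi_1,\alpha\pi_2,\beta\pi_3)$, $\alpha$ is bound in $\pi_2$ and $\beta$ in $\pi_3$); $\sigma\pi$ denotes capture-avoiding simultaneous substitution. A context $\Gamma$ is a finite set of declarations $\alpha:B$ of distinct proof variables. "$\pi$ is a proof-term of $\Gamma \vdash_{\mathcal R} A$" is defined inductively: (axiom) $\alpha$ is one of $\Gamma \vdash_{\mathcal R} A$ if $\alpha:B \in \Gamma$ and $B \longrightarrow_{ - } C \longleftarrow_{+} A$ for some $C$; ($\Rightarrow$-intro)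 if $\pi$ is one of $\Gamma, \alpha:A \vdash_{\mathcal R} B$ and $C \longrightarrow_{+} (A \Rightarrow B)$ then $\lambda\alpha\,\pi$ is one of $\Gamma \vdash_{\mathcal R} C$; ($\Rightarrow$-elim) if $\pi_1$ is one of $\Gamma\vdash_{\mathcal R} C$ with $C \longrightarrow_{ - } (A \Rightarrow B)$ and $\pi_2$ one of $\Gamma \vdash_{\mathcal R} A$, then $(\pi_1\,\pi_2)$ is one of $\Gamma \vdash_{\mathcal R} B$; ($\wedge$-intro) if $\pi_1$ is one of $\Gamma \vdash_{\mathcal R} A$, $\pi_2$ one of $\Gamma\vdash_{\mathcal R} B$ and $C \longrightarrow_{+} (A\wedge B)$, then $\langle\pi_1,\pi_2\rangle$ is one of $\Gamma \vdash_{\mathcal R} C$; ($\wedge$-elim) if $\pi$ is one of $\Gamma \vdash_{\mathcal R} C$ and $C \longrightarrow_{ - } (A \wedge B)$ then $\mathit{fst}(\pi)$ is one of $\Gamma\vdash_{\mathcal R} A$ and $\mathit{snd}(\pi)$ one of $\Gamma \vdash_{\mathcal R} B$; ($\vee$-intro) if $\pi$ is one of $\Gamma\vdash_{\mathcal R} A$ (resp. $\Gamma \vdash_{\mathcal R} B$) and $C \longrightarrow_{+} (A \vee B)$ then $i(\pi)$ (resp. $j(\pi)$) is one of $\Gamma \vdash_{\mathcal R} C$; ($\vee$-elim) if $\pi_1$ is one of $\Gamma\vdash_{\mathcal R} D$ with $D \longrightarrow_{ - } (A\vee B)$, $\pi_2$ one of $\Gamma,\alpha:A \vdash_{\mathcal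 R} C$ and $\pi_3$ one of $\Gamma,\beta:B\vdash_{\mathcal R} C$, then $\delta(\pi_1,\alpha\pi_2,\beta\pi_3)$ is one of $\Gamma \vdash_{\mathcal R} C$; ($\bot$-elim) if $\pi$ is one of $\Gamma \vdash_{\mathcal R} B$ with $B \longrightarrow_{ - } \bot$ then $\delta_\bot(\pi)$ is one of $\Gamma \vdash_{\mathcal R} A$ for every $A$. Proof reduction: $\triangleright^1$ is the closure under all term contexts of $(\lambda\alpha\,\pi_1\;\pi_2) \triangleright [\pi_2/\alpha]\pi_1$, $\mathit{fst}(\langle\pi_1,\pi_2\rangle) \triangleright \pi_1$, $\mathit{snd}(\langle\pi_1,\pi_2\rangle)\triangleright \pi_2$, $\delta(i(\pi_1),\alpha\pi_2,\beta\pi_3)\triangleright[\pi_1/\alpha]\pi_2$, $\delta(j(\pi_1),\alpha\pi_2,\beta\pi_3)\triangleright[\pi_1/\beta]\pi_3$; $\triangleright$ is its reflexive-transitive closure ("$\pi$ reduces to $\pi'$"). A proof-term is strongly normalizable if there is no infinite $\triangleright^1$-sequence from it. A proof-term is neutral if it is a variable or of the form $(\pi_1\,\pi_2)$, $\mathit{fst}(\pi)$, $\mathit{snd}(\pi)$, $\delta(\pi_1,\alpha\pi_2,\beta\pi_3)$ or $\delta_\bot(\pi)$. A set $R$ of proof-terms is a reducibility candidate if: every element is strongly normalizable; $\pi\in R$ and $\pi\triangleright\pi'$ imply $\pi'\in R$; if $\pi$ is neutral and every $\pi'$ with $\pi\triangleright^1\pi'$ is in $R$ then $\pi\in R$. A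 pre-model assigns a reducibility candidate $\hat P$ to each atomic $P$. Then $|P| = \hat P$; $\pi \in |A \Rightarrow B|$ iff $\pi$ is strongly normalizable and whenever $\pi$ reduces to $\lambda\alpha\,\pi_1$, $[\pi'/\alpha]\pi_1 \in |B|$ for all $\pi' \in |A|$; $\pi \in |A \wedge B|$ iff $\pi$ is strongly normalizable and whenever $\pi$ reduces to $\langle\pi_1,\pi_2\rangle$, $\pi_1\in|A|$ and $\pi_2\in|B|$; $\pi \in |A\vee B|$ iff $\pi$ is strongly normalizable and whenever $\pi$ reduces to $i(\pi_1)$ (resp. $j(\pi_2)$), $\pi_1\in|A|$ (resp. $\pi_2\in|B|$); $|\bot|$ is the set of strongly normalizable proof-terms. A pre-model of $\mathcal R$ is a pre-model with $|P|\subseteq|A|$ for each negative rule $P\longrightarrow A$ and $|A|\subseteq|P|$ for each positive rule $P\longrightarrow A$. -}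

module Defs where

open import Data.Nat using (ℕ; zero; suc)
open import Data.List using (List; []; _∷_)
open import Data.Maybe using (Maybe; just; nothing)
open import Data.Product using (Σ; _×_; _,_; ∃)
open import Relation.Binary.PropositionalEquality using (_≡_)
open import Relation.Binary.Construct.Closure.ReflexiveTransitive using (Star)
open import Induction.WellFounded using (Acc)

data Form (Atom : Set) : Set where
  atom : Atom → Form Atom
  ⊥′   : Form Atom
  _⇒_  : Form Atom → Form Atom → Form Atom
  _∧_  : Form Atom → Form Atom → Form Atom
  _∨_  : Form Atom → Form Atom → Form Atom

infixr 5 _⇒_
infixr 6 _∨_
infixr 7 _∧_

data Sign : Set where
  neg pos : Sign

flip : Sign → Sign
flip neg = pos
flip pos = neg

-- Polarized rewriting.  A polarized rewrite system is a pair of sets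
-- of rules  P ⟶ A, given as predicates  R₋ R₊ : Atom → Form Atom → Set
-- (R₋ P A holds iff  P ⟶ A  is a negative rule, etc.).

module _ {Atom : Set} (R₋ R₊ : Atom → Form Atom → Set) where

  data Step : Sign → Form Atom → Form Atom → Set where
    rule₋ : ∀ {P A} → R₋ P A → Step neg (atom P) A
    rule₊ : ∀ {P A} → R₊ P A → Step pos (atom P) A
    ⇒ˡ : ∀ {s A A' B} → Step (flip s) A A' → Step s (A ⇒ B) (A' ⇒ B)
    ⇒ʳ : ∀ {s A B B'} → Step s B B' → Step s (A ⇒ B) (A ⇒ B')
    ∧ˡ : ∀ {s A A' B} → Step s A A' → Step s (A ∧ B) (A' ∧ B)
    ∧ʳ : ∀ {s A B B'} → Step s B B' → Step s (A ∧ B) (A ∧ B')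
    ∨ˡ : ∀ {s A A' B} → Step s A A' → Step s (A ∨ B) (A' ∨ B)
    ∨ʳ : ∀ {s A B B'} → Step s B B' → Step s (A ∨ B) (A ∨ B')

  Red : Sign → Form Atom → Form Atom → Set
  Red s = Star (Step s)

  Commute : Set
  Commute = ∀ {A B C} → Red neg B A → Red pos B C →
            Σ (Form Atom) λ D → Red pos A D × Red neg C D

-- Proof-terms, with de Bruijn indices for proof variables.
--   lam t       : λα t      (α = index 0 in t)
--   case t u v  : δ(t, α u, β v)   (α = index 0 in u, β = index 0 in v)
--   abort t     : δ_⊥(t)
--   inl / inr   : i / j

data Term : Set where
  var   : ℕ → Term
  lam   : Term → Term
  app   : Term → Term → Term
  pair  : Term → Term → Term
  fst   : Term → Term
  snd   : Term → Term
  inl   : Term → Term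
  inr   : Term → Term
  case  : Term → Term → Term → Term
  abort : Term → Term

ext : (ℕ → ℕ) → ℕ → ℕ
ext ρ zero    = zero
ext ρ (suc n) = suc (ρ n)

rename : (ℕ → ℕ) → Term → Term
rename ρ (var x)      = var (ρ x)
rename ρ (lam t)      = lam (rename (ext ρ) t)
rename ρ (app t u)    = app (rename ρ t) (rename ρ u)
rename ρ (pair t u)   = pair (rename ρ t) (rename ρ u)
rename ρ (fst t)      = fst (rename ρ t)
rename ρ (snd t)      = snd (rename ρ t)
rename ρ (inl t)      = inl (rename ρ t)
rename ρ (inr t)      = inr (rename ρ t)
rename ρ (case t u v) = case (rename ρ t) (rename (ext ρ) u) (rename (ext ρ) v)
rename ρ (abort t)    = abort (rename ρ t)

exts : (ℕ → Term) → ℕ → Term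
exts σ zero    = var zero
exts σ (suc n) = rename suc (σ n)

subst : (ℕ → Term) → Term → Term
subst σ (var x)      = σ x
subst σ (lam t)      = lam (subst (exts σ) t)
subst σ (app t u)    = app (subst σ t) (subst σ u)
subst σ (pair t u)   = pair (subst σ t) (subst σ u)
subst σ (fst t)      = fst (subst σ t)
subst σ (snd t)      = snd (subst σ t)
subst σ (inl t)      = inl (subst σ t)
subst σ (inr t)      = inr (subst σ t)
subst σ (case t u v) = case (subst σ t) (subst (exts σ) u) (subst (exts σ) v)
subst σ (abort t)    = abort (subst σ t)

-- [u/α]t  where α is the variable bound by the enclosing binder
single : Term → ℕ → Term
single u zero    = u
single u (suc n) = var n

_[_] : Term → Term → Term
t [ u ] = subst (single u) t

-- application of a partial substitution (undefined = identity)
applySub : (ℕ → Maybe Term) → Term → Term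
applySub σ = subst σ'
  where
  σ' : ℕ → Term
  σ' x with σ x
  ... | just t  = t
  ... | nothing = var x

infix 4 _▷¹_ _▷_

data _▷¹_ : Term → Term → Set where
  β⇒   : ∀ {t u} → app (lam t) u ▷¹ t [ u ]
  β∧₁  : ∀ {t u} → fst (pair t u) ▷¹ t
  β∧₂  : ∀ {t u} → snd (pair t u) ▷¹ u
  β∨₁  : ∀ {t u v} → case (inl t) u v ▷¹ u [ t ]
  β∨₂  : ∀ {t u v} → case (inr t) u v ▷¹ v [ t ]
  ξlam   : ∀ {t t'} → t ▷¹ t' → lam t ▷¹ lam t'
  ξappˡ  : ∀ {t t' u} → t ▷¹ t' → app t u ▷¹ app t' u
  ξappʳ  : ∀ {t u u'} → u ▷¹ u' → app t u ▷¹ app t u'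
  ξpairˡ : ∀ {t t' u} → t ▷¹ t' → pair t u ▷¹ pair t' u
  ξpairʳ : ∀ {t u u'} → u ▷¹ u' → pair t u ▷¹ pair t u'
  ξfst   : ∀ {t t'} → t ▷¹ t' → fst t ▷¹ fst t'
  ξsnd   : ∀ {t t'} → t ▷¹ t' → snd t ▷¹ snd t'
  ξinl   : ∀ {t t'} → t ▷¹ t' → inl t ▷¹ inl t'
  ξinr   : ∀ {t t'} → t ▷¹ t' → inr t ▷¹ inr t'
  ξcase₁ : ∀ {t t' u v} → t ▷¹ t' → case t u v ▷¹ case t' u v
  ξcase₂ : ∀ {t u u' v} → u ▷¹ u' → case t u v ▷¹ case t u' v
  ξcase₃ : ∀ {t u v v'} → v ▷¹ v' → case t u v ▷¹ case t u v'
  ξabort : ∀ {t t'} → t ▷¹ t' → abort t ▷¹ abort t'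

_▷_ : Term → Term → Set
_▷_ = Star _▷¹_

_◁¹_ : Term → Term → Set
t' ◁¹ t = t ▷¹ t'

SN : Term → Set
SN = Acc _◁¹_

data Neutral : Term → Set where
  var   : ∀ {x} → Neutral (var x)
  app   : ∀ {t u} → Neutral (app t u)
  fst   : ∀ {t} → Neutral (fst t)
  snd   : ∀ {t} → Neutral (snd t)
  case  : ∀ {t u v} → Neutral (case t u v)
  abort : ∀ {t} → Neutral (abort t)

record Candidate (R : Term → Set) : Set where
  field
    cr-sn      : ∀ {t} → R t → SN t
    cr-red     : ∀ {t t'} → R t → t ▷ t' → R t'
    cr-neutral : ∀ {t} → Neutral t → (∀ {t'} → t ▷¹ t' → R t') → R t

record PreModel (Atom : Set) : Set₁ where
  field
    ⟦_⟧ₐ : Atom → Term → Set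
    candidate : ∀ P → Candidate (⟦ P ⟧ₐ)

module _ {Atom : Set} (M : PreModel Atom) where
  open PreModel M

  ∣_∣ : Form Atom → Term → Set
  ∣ atom P ∣ t = ⟦ P ⟧ₐ t
  ∣ ⊥′ ∣ t = SN t
  ∣ A ⇒ B ∣ t = SN t × (∀ t₁ → t ▷ lam t₁ → ∀ u → ∣ A ∣ u → ∣ B ∣ (t₁ [ u ]))
  ∣ A ∧ B ∣ t = SN t × (∀ t₁ t₂ → t ▷ pair t₁ t₂ → ∣ A ∣ t₁ × ∣ B ∣ t₂)
  ∣ A ∨ B ∣ t = SN t × (∀ t₁ → t ▷ inl t₁ → ∣ A ∣ t₁)
                     × (∀ t₂ → t ▷ inr t₂ → ∣ B ∣ t₂)

record IsPreModelOf {Atom : Set} (R₋ R₊ : Atom → Form Atom → Set)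
                    (M : PreModel Atom) : Set where
  field
    negRule : ∀ {P A} → R₋ P A → ∀ t → ∣ M ∣ (atom P) t → ∣ M ∣ A t
    posRule : ∀ {P A} → R₊ P A → ∀ t → ∣ M ∣ A t → ∣ M ∣ (atom P) t

-- Typing: Γ ⊢_R t : A.  Contexts are lists; de Bruijn index n refers
-- to the n-th entry.

data _∋_∶_ {Atom : Set} : List (Form Atom) → ℕ → Form Atom → Set where
  here  : ∀ {Γ A} → (A ∷ Γ) ∋ zero ∶ A
  there : ∀ {Γ A B n} → Γ ∋ n ∶ A → (B ∷ Γ) ∋ suc n ∶ A

module _ {Atom : Set} (R₋ R₊ : Atom → Form Atom → Set) where

  data Proves : List (Form Atom) → Term → Form Atom → Set where
    ax    : ∀ {Γ α A B C} → Γ ∋ α ∶ B → Red R₋ R₊ neg B C → Red R₋ R₊ pos A C →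
            Proves Γ (var α) A
    ⇒I    : ∀ {Γ t A B C} → Proves (A ∷ Γ) t B → Red R₋ R₊ pos C (A ⇒ B) →
            Proves Γ (lam t) C
    ⇒E    : ∀ {Γ t u A B C} → Proves Γ t C → Red R₋ R₊ neg C (A ⇒ B) →
            Proves Γ u A → Proves Γ (app t u) B
    ∧I    : ∀ {Γ t u A B C} → Proves Γ t A → Proves Γ u B →
            Red R₋ R₊ pos C (A ∧ B) → Proves Γ (pair t u) C
    ∧E₁   : ∀ {Γ t A B C} → Proves Γ t C → Red R₋ R₊ neg C (A ∧ B) →
            Proves Γ (fst t) A
    ∧E₂   : ∀ {Γ t A B C} → Proves Γ t C → Red R₋ R₊ neg C (A ∧ B) →
            Proves Γ (snd t) B
    ∨I₁   : ∀ {Γ t A B C} → Proves Γ t A → Red R₋ R₊ pos C (A ∨ B) →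
            Proves Γ (inl t) C
    ∨I₂   : ∀ {Γ t A B C} → Proves Γ t B → Red R₋ R₊ pos C (A ∨ B) →
            Proves Γ (inr t) C
    ∨E    : ∀ {Γ t u v A B C D} → Proves Γ t D → Red R₋ R₊ neg D (A ∨ B) →
            Proves (A ∷ Γ) u C → Proves (B ∷ Γ) v C → Proves Γ (case t u v) C
    ⊥E    : ∀ {Γ t A B} → Proves Γ t B → Red R₋ R₊ neg B ⊥′ →
            Proves Γ (abort t) A

Adapted : {Atom : Set} → PreModel Atom → List (Form Atom) → (ℕ → Maybe Term) → Set
Adapted M Γ σ = ∀ α t → σ α ≡ just t → ∃ λ B → (Γ ∋ α ∶ B) × ∣ M ∣ B t

-- Tait–Girard reducibility: each |A| is a reducibility candidate, every
-- introduction and elimination rule preserves membership in the interpretation,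
-- and the pre-model inclusions |P| ⊆ |A| (negative rules) and |A| ⊆ |P|
-- (positive rules) propagate to |B| ⊆ |C| whenever B ⟶₋ C and to |C| ⊆ |A|
-- whenever A ⟶₊ C, because the sign flip on the left of ⇒ matches the
-- contravariance of |A ⇒ B| in A.
module Submission where

open import Defs
open import Data.Nat using (ℕ; zero; suc)
open import Data.List using (List; _∷_)
open import Data.Maybe using (Maybe; just; nothing)
open import Data.Empty using (⊥-elim)
open import Data.Product using (_×_; _,_; ∃; proj₁; proj₂)
open import Function using (_∘_)
open import Relation.Nullary using (¬_)
open import Relation.Unary using (_⊆_)
open import Relation.Binary.PropositionalEquality
  using (_≡_; _≗_; refl; cong; cong₂; sym; trans; module ≡-Reasoning)
  renaming (subst to transport)
open import Relation.Binary.Construct.Closure.ReflexiveTransitive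
  using (ε; _◅_; _◅◅_)
open import Induction.WellFounded using (acc)

cong₃ : ∀ {A B C D : Set} (f : A → B → C → D) {a a' b b' c c'} →
        a ≡ a' → b ≡ b' → c ≡ c' → f a b c ≡ f a' b' c'
cong₃ f refl refl refl = refl

infixr 5 _•_
_•_ : Term → (ℕ → Term) → ℕ → Term
(u • σ) zero    = u
(u • σ) (suc n) = σ n

-- Each fusion law is stated for an arbitrary pointwise description of the
-- composite, so that the binder cases need no separate congruence lemmas.

rename-as-subst-ext : ∀ {ρ σ} → var ∘ ρ ≗ σ → var ∘ ext ρ ≗ exts σ
rename-as-subst-ext h zero    = refl
rename-as-subst-ext h (suc x) = cong (rename suc) (h x)

rename-as-subst : ∀ {ρ σ} → var ∘ ρ ≗ σ → ∀ t → rename ρ t ≡ subst σ t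
rename-as-subst h (var x)      = h x
rename-as-subst h (lam t)      = cong lam (rename-as-subst (rename-as-subst-ext h) t)
rename-as-subst h (app t u)    = cong₂ app (rename-as-subst h t) (rename-as-subst h u)
rename-as-subst h (pair t u)   = cong₂ pair (rename-as-subst h t) (rename-as-subst h u)
rename-as-subst h (fst t)      = cong fst (rename-as-subst h t)
rename-as-subst h (snd t)      = cong snd (rename-as-subst h t)
rename-as-subst h (inl t)      = cong inl (rename-as-subst h t)
rename-as-subst h (inr t)      = cong inr (rename-as-subst h t)
rename-as-subst h (case t u v) = cong₃ case (rename-as-subst h t)
  (rename-as-subst (rename-as-subst-ext h) u) (rename-as-subst (rename-as-subst-ext h) v)
rename-as-subst h (abort t)    = cong abort (rename-as-subst h t)

subst-rename-ext : ∀ {σ ρ τ} → σ ∘ ρ ≗ τ → exts σ ∘ ext ρ ≗ exts τ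
subst-rename-ext h zero    = refl
subst-rename-ext h (suc x) = cong (rename suc) (h x)

subst-rename : ∀ {σ ρ τ} → σ ∘ ρ ≗ τ → ∀ t → subst σ (rename ρ t) ≡ subst τ t
subst-rename h (var x)      = h x
subst-rename h (lam t)      = cong lam (subst-rename (subst-rename-ext h) t)
subst-rename h (app t u)    = cong₂ app (subst-rename h t) (subst-rename h u)
subst-rename h (pair t u)   = cong₂ pair (subst-rename h t) (subst-rename h u)
subst-rename h (fst t)      = cong fst (subst-rename h t)
subst-rename h (snd t)      = cong snd (subst-rename h t)
subst-rename h (inl t)      = cong inl (subst-rename h t)
subst-rename h (inr t)      = cong inr (subst-rename h t)
subst-rename h (case t u v) = cong₃ case (subst-rename h t)
  (subst-rename (subst-rename-ext h) u) (subst-rename (subst-rename-ext h) v)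
subst-rename h (abort t)    = cong abort (subst-rename h t)

rename-rename : ∀ {ρ' ρ ρ''} → ρ' ∘ ρ ≗ ρ'' → ∀ t → rename ρ' (rename ρ t) ≡ rename ρ'' t
rename-rename {ρ'} {ρ} {ρ''} h t = begin
  rename ρ' (rename ρ t)       ≡⟨ rename-as-subst (λ _ → refl) (rename ρ t) ⟩
  subst (var ∘ ρ') (rename ρ t) ≡⟨ subst-rename (cong var ∘ h) t ⟩
  subst (var ∘ ρ'') t          ≡⟨ sym (rename-as-subst (λ _ → refl) t) ⟩
  rename ρ'' t                 ∎
  where open ≡-Reasoning

rename-subst-ext : ∀ {ρ σ τ} → rename ρ ∘ σ ≗ τ → rename (ext ρ) ∘ exts σ ≗ exts τ
rename-subst-ext h zero    = refl
rename-subst-ext {ρ} {σ} h (suc x) = begin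
  rename (ext ρ) (rename suc (σ x)) ≡⟨ rename-rename (λ _ → refl) (σ x) ⟩
  rename (suc ∘ ρ) (σ x)            ≡⟨ sym (rename-rename (λ _ → refl) (σ x)) ⟩
  rename suc (rename ρ (σ x))       ≡⟨ cong (rename suc) (h x) ⟩
  rename suc _                      ∎
  where open ≡-Reasoning

rename-subst : ∀ {ρ σ τ} → rename ρ ∘ σ ≗ τ → ∀ t → rename ρ (subst σ t) ≡ subst τ t
rename-subst h (var x)      = h x
rename-subst h (lam t)      = cong lam (rename-subst (rename-subst-ext h) t)
rename-subst h (app t u)    = cong₂ app (rename-subst h t) (rename-subst h u)
rename-subst h (pair t u)   = cong₂ pair (rename-subst h t) (rename-subst h u)
rename-subst h (fst t)      = cong fst (rename-subst h t)
rename-subst h (snd t)      = cong snd (rename-subst h t)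
rename-subst h (inl t)      = cong inl (rename-subst h t)
rename-subst h (inr t)      = cong inr (rename-subst h t)
rename-subst h (case t u v) = cong₃ case (rename-subst h t)
  (rename-subst (rename-subst-ext h) u) (rename-subst (rename-subst-ext h) v)
rename-subst h (abort t)    = cong abort (rename-subst h t)

subst-subst-ext : ∀ {σ τ υ} → subst σ ∘ τ ≗ υ → subst (exts σ) ∘ exts τ ≗ exts υ
subst-subst-ext h zero    = refl
subst-subst-ext {σ} {τ} h (suc x) = begin
  subst (exts σ) (rename suc (τ x)) ≡⟨ subst-rename (λ _ → refl) (τ x) ⟩
  subst (rename suc ∘ σ) (τ x)      ≡⟨ sym (rename-subst (λ _ → refl) (τ x)) ⟩
  rename suc (subst σ (τ x))        ≡⟨ cong (rename suc) (h x) ⟩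
  rename suc _                      ∎
  where open ≡-Reasoning

subst-subst : ∀ {σ τ υ} → subst σ ∘ τ ≗ υ → ∀ t → subst σ (subst τ t) ≡ subst υ t
subst-subst h (var x)      = h x
subst-subst h (lam t)      = cong lam (subst-subst (subst-subst-ext h) t)
subst-subst h (app t u)    = cong₂ app (subst-subst h t) (subst-subst h u)
subst-subst h (pair t u)   = cong₂ pair (subst-subst h t) (subst-subst h u)
subst-subst h (fst t)      = cong fst (subst-subst h t)
subst-subst h (snd t)      = cong snd (subst-subst h t)
subst-subst h (inl t)      = cong inl (subst-subst h t)
subst-subst h (inr t)      = cong inr (subst-subst h t)
subst-subst h (case t u v) = cong₃ case (subst-subst h t)
  (subst-subst (subst-subst-ext h) u) (subst-subst (subst-subst-ext h) v)
subst-subst h (abort t)    = cong abort (subst-subst h t)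

subst-id-ext : ∀ {σ} → σ ≗ var → exts σ ≗ var
subst-id-ext h zero    = refl
subst-id-ext h (suc x) = cong (rename suc) (h x)

subst-id : ∀ {σ} → σ ≗ var → ∀ t → subst σ t ≡ t
subst-id h (var x)      = h x
subst-id h (lam t)      = cong lam (subst-id (subst-id-ext h) t)
subst-id h (app t u)    = cong₂ app (subst-id h t) (subst-id h u)
subst-id h (pair t u)   = cong₂ pair (subst-id h t) (subst-id h u)
subst-id h (fst t)      = cong fst (subst-id h t)
subst-id h (snd t)      = cong snd (subst-id h t)
subst-id h (inl t)      = cong inl (subst-id h t)
subst-id h (inr t)      = cong inr (subst-id h t)
subst-id h (case t u v) = cong₃ case (subst-id h t) (subst-id (subst-id-ext h) u) (subst-id (subst-id-ext h) v)
subst-id h (abort t)    = cong abort (subst-id h t)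

exts-[] : ∀ σ u t → (subst (exts σ) t) [ u ] ≡ subst (u • σ) t
exts-[] σ u = subst-subst single-exts
  where
  single-exts : subst (single u) ∘ exts σ ≗ u • σ
  single-exts zero    = refl
  single-exts (suc x) = trans (subst-rename (λ _ → refl) (σ x)) (subst-id (λ _ → refl) (σ x))

subst-[] : ∀ σ t u → subst σ (t [ u ]) ≡ (subst (exts σ) t) [ subst σ u ]
subst-[] σ t u = trans (subst-subst single-subst t) (sym (exts-[] σ (subst σ u) t))
  where
  single-subst : subst σ ∘ single u ≗ subst σ u • σ
  single-subst zero    = refl
  single-subst (suc x) = refl

subst-▷¹ : ∀ σ {t t'} → t ▷¹ t' → subst σ t ▷¹ subst σ t'
subst-▷¹ σ (β⇒ {t} {u})     rewrite subst-[] σ t u = β⇒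
subst-▷¹ σ β∧₁              = β∧₁
subst-▷¹ σ β∧₂              = β∧₂
subst-▷¹ σ (β∨₁ {t} {u})    rewrite subst-[] σ u t = β∨₁
subst-▷¹ σ (β∨₂ {t} {_} {v}) rewrite subst-[] σ v t = β∨₂
subst-▷¹ σ (ξlam p)         = ξlam (subst-▷¹ (exts σ) p)
subst-▷¹ σ (ξappˡ p)        = ξappˡ (subst-▷¹ σ p)
subst-▷¹ σ (ξappʳ p)        = ξappʳ (subst-▷¹ σ p)
subst-▷¹ σ (ξpairˡ p)       = ξpairˡ (subst-▷¹ σ p)
subst-▷¹ σ (ξpairʳ p)       = ξpairʳ (subst-▷¹ σ p)
subst-▷¹ σ (ξfst p)         = ξfst (subst-▷¹ σ p)
subst-▷¹ σ (ξsnd p)         = ξsnd (subst-▷¹ σ p)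
subst-▷¹ σ (ξinl p)         = ξinl (subst-▷¹ σ p)
subst-▷¹ σ (ξinr p)         = ξinr (subst-▷¹ σ p)
subst-▷¹ σ (ξcase₁ p)       = ξcase₁ (subst-▷¹ σ p)
subst-▷¹ σ (ξcase₂ p)       = ξcase₂ (subst-▷¹ (exts σ) p)
subst-▷¹ σ (ξcase₃ p)       = ξcase₃ (subst-▷¹ (exts σ) p)
subst-▷¹ σ (ξabort p)       = ξabort (subst-▷¹ σ p)

subst-▷ : ∀ σ {t t'} → t ▷ t' → subst σ t ▷ subst σ t'
subst-▷ σ ε       = ε
subst-▷ σ (p ◅ r) = subst-▷¹ σ p ◅ subst-▷ σ r

SN-subst⁻ : ∀ σ {t} → SN (subst σ t) → SN t
SN-subst⁻ σ (acc r) = acc λ p → SN-subst⁻ σ (r (subst-▷¹ σ p))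

SN-[]⁻ : ∀ u {t} → SN (t [ u ]) → SN t
SN-[]⁻ u = SN-subst⁻ (single u)

SN-▷ : ∀ {t t'} → SN t → t ▷ t' → SN t'
SN-▷ s       ε       = s
SN-▷ (acc r) (p ◅ q) = SN-▷ (r p) q

SN-lam : ∀ {t} → SN t → SN (lam t)
SN-lam (acc r) = acc λ { (ξlam p) → SN-lam (r p) }

SN-pair : ∀ {t u} → SN t → SN u → SN (pair t u)
SN-pair st@(acc r) su@(acc q) =
  acc λ { (ξpairˡ p) → SN-pair (r p) su ; (ξpairʳ p) → SN-pair st (q p) }

SN-inl : ∀ {t} → SN t → SN (inl t)
SN-inl (acc r) = acc λ { (ξinl p) → SN-inl (r p) }

SN-inr : ∀ {t} → SN t → SN (inr t)
SN-inr (acc r) = acc λ { (ξinr p) → SN-inr (r p) }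

neutral-▷-first-step : ∀ {t w} → Neutral t → ¬ Neutral w → t ▷ w → ∃ λ t' → t ▷¹ t' × t' ▷ w
neutral-▷-first-step n ¬n ε       = ⊥-elim (¬n n)
neutral-▷-first-step n ¬n (p ◅ r) = _ , p , r

lam-▷-lam : ∀ {s t} → lam s ▷ lam t → s ▷ t
lam-▷-lam ε            = ε
lam-▷-lam (ξlam p ◅ r) = p ◅ lam-▷-lam r

pair-▷-pair : ∀ {a b c d} → pair a b ▷ pair c d → a ▷ c × b ▷ d
pair-▷-pair ε              = ε , ε
pair-▷-pair (ξpairˡ p ◅ r) = let a , b = pair-▷-pair r in p ◅ a , b
pair-▷-pair (ξpairʳ p ◅ r) = let a , b = pair-▷-pair r in a , p ◅ b

inl-▷-inl : ∀ {a b} → inl a ▷ inl b → a ▷ b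
inl-▷-inl ε            = ε
inl-▷-inl (ξinl p ◅ r) = p ◅ inl-▷-inl r

inr-▷-inr : ∀ {a b} → inr a ▷ inr b → a ▷ b
inr-▷-inr ε            = ε
inr-▷-inr (ξinr p ◅ r) = p ◅ inr-▷-inr r

inl-⋫-inr : ∀ {a b} → ¬ inl a ▷ inr b
inl-⋫-inr (ξinl p ◅ r) = inl-⋫-inr r

inr-⋫-inl : ∀ {a b} → ¬ inr a ▷ inl b
inr-⋫-inl (ξinr p ◅ r) = inr-⋫-inl r

module Interpretation {Atom : Set} (M : PreModel Atom) where
  open PreModel M
  open Candidate

  ∣∣-candidate : ∀ A → Candidate (∣ M ∣ A)
  ∣∣-candidate (atom P) = candidate P
  ∣∣-candidate ⊥′ = record
    { cr-sn      = λ s → s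
    ; cr-red     = SN-▷
    ; cr-neutral = λ _ f → acc f
    }
  ∣∣-candidate (A ⇒ B) = record
    { cr-sn      = proj₁
    ; cr-red     = λ (s , f) r → SN-▷ s r , λ t₁ q → f t₁ (r ◅◅ q)
    ; cr-neutral = λ n f → acc (proj₁ ∘ f) , λ t₁ q →
        let _ , p , r = neutral-▷-first-step n (λ ()) q in proj₂ (f p) t₁ r
    }
  ∣∣-candidate (A ∧ B) = record
    { cr-sn      = proj₁
    ; cr-red     = λ (s , f) r → SN-▷ s r , λ t₁ t₂ q → f t₁ t₂ (r ◅◅ q)
    ; cr-neutral = λ n f → acc (proj₁ ∘ f) , λ t₁ t₂ q →
        let _ , p , r = neutral-▷-first-step n (λ ()) q in proj₂ (f p) t₁ t₂ r
    }
  ∣∣-candidate (A ∨ B) = record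
    { cr-sn      = proj₁
    ; cr-red     = λ (s , f , g) r → SN-▷ s r , (λ t₁ q → f t₁ (r ◅◅ q)) , (λ t₂ q → g t₂ (r ◅◅ q))
    ; cr-neutral = λ n f → acc (proj₁ ∘ f)
        , (λ t₁ q → let _ , p , r = neutral-▷-first-step n (λ ()) q in proj₁ (proj₂ (f p)) t₁ r)
        , (λ t₂ q → let _ , p , r = neutral-▷-first-step n (λ ()) q in proj₂ (proj₂ (f p)) t₂ r)
    }

  ∣∣-SN : ∀ A {t} → ∣ M ∣ A t → SN t
  ∣∣-SN A = cr-sn (∣∣-candidate A)

  ∣∣-▷ : ∀ A {t t'} → ∣ M ∣ A t → t ▷ t' → ∣ M ∣ A t'
  ∣∣-▷ A = cr-red (∣∣-candidate A)

  ∣∣-▷¹ : ∀ A {t t'} → ∣ M ∣ A t → t ▷¹ t' → ∣ M ∣ A t'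
  ∣∣-▷¹ A h p = ∣∣-▷ A h (p ◅ ε)

  ∣∣-neutral : ∀ A {t} → Neutral t → (∀ {t'} → t ▷¹ t' → ∣ M ∣ A t') → ∣ M ∣ A t
  ∣∣-neutral A = cr-neutral (∣∣-candidate A)

  ∣∣-var : ∀ A x → ∣ M ∣ A (var x)
  ∣∣-var A x = ∣∣-neutral A var λ ()

  ∣∣-lam : ∀ A B {t} → (∀ u → ∣ M ∣ A u → ∣ M ∣ B (t [ u ])) → ∣ M ∣ (A ⇒ B) (lam t)
  ∣∣-lam A B h = SN-lam (SN-[]⁻ (var 0) (∣∣-SN B (h (var 0) (∣∣-var A 0))))
                   , λ t₁ q u hu → ∣∣-▷ B (h u hu) (subst-▷ (single u) (lam-▷-lam q))

  ∣∣-pair : ∀ A B {a b} → ∣ M ∣ A a → ∣ M ∣ B b → ∣ M ∣ (A ∧ B) (pair a b)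
  ∣∣-pair A B ha hb = SN-pair (∣∣-SN A ha) (∣∣-SN B hb) , λ t₁ t₂ q →
    let qa , qb = pair-▷-pair q in ∣∣-▷ A ha qa , ∣∣-▷ B hb qb

  ∣∣-inl : ∀ A B {a} → ∣ M ∣ A a → ∣ M ∣ (A ∨ B) (inl a)
  ∣∣-inl A B ha = SN-inl (∣∣-SN A ha)
                , (λ t₁ q → ∣∣-▷ A ha (inl-▷-inl q)) , (λ t₂ q → ⊥-elim (inl-⋫-inr q))

  ∣∣-inr : ∀ A B {b} → ∣ M ∣ B b → ∣ M ∣ (A ∨ B) (inr b)
  ∣∣-inr A B hb = SN-inr (∣∣-SN B hb)
                , (λ t₁ q → ⊥-elim (inr-⋫-inl q)) , (λ t₂ q → ∣∣-▷ B hb (inr-▷-inr q))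

  -- The eliminations are neutral, so by CR3 it suffices to check their one-step
  -- reducts, by well-founded induction on the strong normalisation of the parts.

  ∣∣-app : ∀ A B {t u} → ∣ M ∣ (A ⇒ B) t → ∣ M ∣ A u → ∣ M ∣ B (app t u)
  ∣∣-app A B ht hu = go (∣∣-SN (A ⇒ B) ht) (∣∣-SN A hu) ht hu
    where
    go : ∀ {t u} → SN t → SN u → ∣ M ∣ (A ⇒ B) t → ∣ M ∣ A u → ∣ M ∣ B (app t u)
    go {u = u} st@(acc rt) su@(acc ru) ht hu = ∣∣-neutral B app λ where
      (β⇒ {t₁})  → proj₂ ht t₁ ε u hu
      (ξappˡ p) → go (rt p) su (∣∣-▷¹ (A ⇒ B) ht p) hu
      (ξappʳ p) → go st (ru p) ht (∣∣-▷¹ A hu p)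

  ∣∣-fst : ∀ A B {t} → ∣ M ∣ (A ∧ B) t → ∣ M ∣ A (fst t)
  ∣∣-fst A B ht = go (∣∣-SN (A ∧ B) ht) ht
    where
    go : ∀ {t} → SN t → ∣ M ∣ (A ∧ B) t → ∣ M ∣ A (fst t)
    go (acc rt) ht = ∣∣-neutral A fst λ where
      (β∧₁ {t₁} {t₂}) → proj₁ (proj₂ ht t₁ t₂ ε)
      (ξfst p)       → go (rt p) (∣∣-▷¹ (A ∧ B) ht p)

  ∣∣-snd : ∀ A B {t} → ∣ M ∣ (A ∧ B) t → ∣ M ∣ B (snd t)
  ∣∣-snd A B ht = go (∣∣-SN (A ∧ B) ht) ht
    where
    go : ∀ {t} → SN t → ∣ M ∣ (A ∧ B) t → ∣ M ∣ B (snd t)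
    go (acc rt) ht = ∣∣-neutral B snd λ where
      (β∧₂ {t₁} {t₂}) → proj₂ (proj₂ ht t₁ t₂ ε)
      (ξsnd p)       → go (rt p) (∣∣-▷¹ (A ∧ B) ht p)

  ∣∣-case : ∀ A B C {t u v} → ∣ M ∣ (A ∨ B) t →
            (∀ a → ∣ M ∣ A a → ∣ M ∣ C (u [ a ])) → (∀ b → ∣ M ∣ B b → ∣ M ∣ C (v [ b ])) →
            ∣ M ∣ C (case t u v)
  ∣∣-case A B C ht hu hv =
    go (∣∣-SN (A ∨ B) ht)
       (SN-[]⁻ (var 0) (∣∣-SN C (hu (var 0) (∣∣-var A 0))))
       (SN-[]⁻ (var 0) (∣∣-SN C (hv (var 0) (∣∣-var B 0))))
       ht hu hv
    where
    go : ∀ {t u v} → SN t → SN u → SN v → ∣ M ∣ (A ∨ B) t →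
         (∀ a → ∣ M ∣ A a → ∣ M ∣ C (u [ a ])) → (∀ b → ∣ M ∣ B b → ∣ M ∣ C (v [ b ])) →
         ∣ M ∣ C (case t u v)
    go st@(acc rt) su@(acc ru) sv@(acc rv) ht hu hv = ∣∣-neutral C case λ where
      (β∨₁ {t₁}) → hu t₁ (proj₁ (proj₂ ht) t₁ ε)
      (β∨₂ {t₂}) → hv t₂ (proj₂ (proj₂ ht) t₂ ε)
      (ξcase₁ p) → go (rt p) su sv (∣∣-▷¹ (A ∨ B) ht p) hu hv
      (ξcase₂ p) → go st (ru p) sv ht (λ a ha → ∣∣-▷¹ C (hu a ha) (subst-▷¹ (single a) p)) hv
      (ξcase₃ p) → go st su (rv p) ht hu (λ b hb → ∣∣-▷¹ C (hv b hb) (subst-▷¹ (single b) p))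

  ∣∣-abort : ∀ A {t} → SN t → ∣ M ∣ A (abort t)
  ∣∣-abort A (acc rt) = ∣∣-neutral A abort λ where
    (ξabort p) → ∣∣-abort A (rt p)

module Adequacy {Atom : Set} (R₋ R₊ : Atom → Form Atom → Set)
                (M : PreModel Atom) (isPreModel : IsPreModelOf R₋ R₊ M) where
  open IsPreModelOf isPreModel
  open Interpretation M

  -- A ⟶ₛ A' gives this inclusion: |A| ⊆ |A'| for s = −, and |A'| ⊆ |A| for s = +.
  _⊑[_]_ : Form Atom → Sign → Form Atom → Set
  A ⊑[ neg ] A' = ∣ M ∣ A ⊆ ∣ M ∣ A'
  A ⊑[ pos ] A' = ∣ M ∣ A' ⊆ ∣ M ∣ A

  ⊑-refl : ∀ s {A} → A ⊑[ s ] A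
  ⊑-refl neg h = h
  ⊑-refl pos h = h

  ⇒-mono : ∀ s {A A' B B'} → A ⊑[ flip s ] A' → B ⊑[ s ] B' → (A ⇒ B) ⊑[ s ] (A' ⇒ B')
  ⇒-mono neg a b (sn , f) = sn , λ t₁ q u hu → b (f t₁ q u (a hu))
  ⇒-mono pos a b (sn , f) = sn , λ t₁ q u hu → b (f t₁ q u (a hu))

  ∧-mono : ∀ s {A A' B B'} → A ⊑[ s ] A' → B ⊑[ s ] B' → (A ∧ B) ⊑[ s ] (A' ∧ B')
  ∧-mono neg a b (sn , f) = sn , λ t₁ t₂ q → let h₁ , h₂ = f t₁ t₂ q in a h₁ , b h₂
  ∧-mono pos a b (sn , f) = sn , λ t₁ t₂ q → let h₁ , h₂ = f t₁ t₂ q in a h₁ , b h₂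

  ∨-mono : ∀ s {A A' B B'} → A ⊑[ s ] A' → B ⊑[ s ] B' → (A ∨ B) ⊑[ s ] (A' ∨ B')
  ∨-mono neg a b (sn , f , g) = sn , (λ t₁ q → a (f t₁ q)) , (λ t₂ q → b (g t₂ q))
  ∨-mono pos a b (sn , f , g) = sn , (λ t₁ q → a (f t₁ q)) , (λ t₂ q → b (g t₂ q))

  Step-⊑ : ∀ {s A A'} → Step R₋ R₊ s A A' → A ⊑[ s ] A'
  Step-⊑ (rule₋ r)     = negRule r _
  Step-⊑ (rule₊ r)     = posRule r _
  Step-⊑ (⇒ˡ {s} p)    = ⇒-mono s (Step-⊑ p) (⊑-refl s)
  Step-⊑ (⇒ʳ {s} p)    = ⇒-mono s (⊑-refl (flip s)) (Step-⊑ p)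
  Step-⊑ (∧ˡ {s} p)    = ∧-mono s (Step-⊑ p) (⊑-refl s)
  Step-⊑ (∧ʳ {s} p)    = ∧-mono s (⊑-refl s) (Step-⊑ p)
  Step-⊑ (∨ˡ {s} p)    = ∨-mono s (Step-⊑ p) (⊑-refl s)
  Step-⊑ (∨ʳ {s} p)    = ∨-mono s (⊑-refl s) (Step-⊑ p)

  Red₋-⊆ : ∀ {A A'} → Red R₋ R₊ neg A A' → ∣ M ∣ A ⊆ ∣ M ∣ A'
  Red₋-⊆ ε       h = h
  Red₋-⊆ (p ◅ r) h = Red₋-⊆ r (Step-⊑ p h)

  Red₊-⊇ : ∀ {A A'} → Red R₋ R₊ pos A A' → ∣ M ∣ A' ⊆ ∣ M ∣ A
  Red₊-⊇ ε       h = h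
  Red₊-⊇ (p ◅ r) h = Step-⊑ p (Red₊-⊇ r h)

  Valid : List (Form Atom) → (ℕ → Term) → Set
  Valid Γ σ = ∀ {α B} → Γ ∋ α ∶ B → ∣ M ∣ B (σ α)

  Valid-• : ∀ {Γ σ A u} → Valid Γ σ → ∣ M ∣ A u → Valid (A ∷ Γ) (u • σ)
  Valid-• g hu here      = hu
  Valid-• g hu (there h) = g h

  adequacy : ∀ {Γ π A σ} → Proves R₋ R₊ Γ π A → Valid Γ σ → ∣ M ∣ A (subst σ π)
  adequacy-binder : ∀ {Γ t A B σ} → Proves R₋ R₊ (A ∷ Γ) t B → Valid Γ σ →
                    ∀ u → ∣ M ∣ A u → ∣ M ∣ B ((subst (exts σ) t) [ u ])

  adequacy (ax h r₋ r₊)           g = Red₊-⊇ r₊ (Red₋-⊆ r₋ (g h))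
  adequacy (⇒I {A = A} {B} d r)   g = Red₊-⊇ r (∣∣-lam A B (adequacy-binder d g))
  adequacy (⇒E {A = A} {B} d r e) g = ∣∣-app A B (Red₋-⊆ r (adequacy d g)) (adequacy e g)
  adequacy (∧I {A = A} {B} d e r) g = Red₊-⊇ r (∣∣-pair A B (adequacy d g) (adequacy e g))
  adequacy (∧E₁ {A = A} {B} d r)  g = ∣∣-fst A B (Red₋-⊆ r (adequacy d g))
  adequacy (∧E₂ {A = A} {B} d r)  g = ∣∣-snd A B (Red₋-⊆ r (adequacy d g))
  adequacy (∨I₁ {A = A} {B} d r)  g = Red₊-⊇ r (∣∣-inl A B (adequacy d g))
  adequacy (∨I₂ {A = A} {B} d r)  g = Red₊-⊇ r (∣∣-inr A B (adequacy d g))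
  adequacy (∨E {A = A} {B} {C} d r e₁ e₂) g =
    ∣∣-case A B C (Red₋-⊆ r (adequacy d g)) (adequacy-binder e₁ g) (adequacy-binder e₂ g)
  adequacy (⊥E {A = A} d r)       g = ∣∣-abort A (∣∣-SN ⊥′ (Red₋-⊆ r (adequacy d g)))

  adequacy-binder {t = t} {B = B} {σ} d g u hu =
    transport (∣ M ∣ B) (sym (exts-[] σ u t)) (adequacy d (Valid-• g hu))

∋-functional : ∀ {Atom : Set} {Γ : List (Form Atom)} {α B B'} → Γ ∋ α ∶ B → Γ ∋ α ∶ B' → B ≡ B'
∋-functional here      here       = refl
∋-functional (there h) (there h') = ∋-functional h h'

theorem1 : {Atom : Set} (R₋ R₊ : Atom → Form Atom → Set) →
           Commute R₋ R₊ →
           (M : PreModel Atom) → IsPreModelOf R₋ R₊ M →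
           (Γ : List (Form Atom)) (A : Form Atom) (π : Term) →
           Proves R₋ R₊ Γ π A →
           (σ : ℕ → Maybe Term) → Adapted M Γ σ →
           ∣ M ∣ A (applySub σ π)
theorem1 R₋ R₊ _ M isPreModel Γ A π d σ adapted = adequacy d valid
  where
  open Adequacy R₋ R₊ M isPreModel
  open Interpretation M using (∣∣-var)

  valid : ∀ {α B} → Γ ∋ α ∶ B → ∣ M ∣ B (applySub σ (var α))
  valid {α} {B} h with σ α in eq
  ... | nothing = ∣∣-var B α
  ... | just t with adapted α t eq
  ...   | B' , h' , ht rewrite ∋-functional h h' = ht
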